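{- No graph of stably matchable pairs has an articulation vertex.
   Context: An articulation vertex of a graph is a vertex whose removal increases the number of connected components. A stable matching instance consists of finite disjoint sets of students and residencies, where each student has a strict linear preference order on a subset of the residencies and each residency has a strict linear preference order on a subset of the students. A matching (set of student–residency pairs, each element in at most one pair) is stable if each of its pairs is mutually acceptable (each member appears in the other's list) and no mutually acceptable pair $(s,r)$ not in it has both $s$ unmatched or preferring $r$ to its partner and $r$ unmatched or preferring $s$ to its partner. The graph of stably matchable pairs of the instance is the bipartite graph whose vertices are all students and residencies and whose edges are the pairs occurring in at least one stable matching. A graph is a graph of stably matchable pairs if it is isomorphic to the graph of stably matchable pairs of some stable matching instance. -}

module Defs where

open import Data.Nat using (ℕ; _<_)
open import Data.Fin using (Fin)
open import Data.Maybe using (Maybe; just; nothing)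
open import Data.List using (List; length; lookup)
open import Data.List.Membership.Propositional using (_∈_)
open import Data.List.Relation.Unary.Unique.Propositional using (Unique)
open import Data.Product using (Σ; ∃; _×_; _,_)
open import Data.Sum using (_⊎_; inj₁; inj₂)
open import Data.Unit using (⊤)
open import Data.Empty using (⊥)
open import Relation.Nullary using (¬_)
open import Relation.Binary.PropositionalEquality using (_≡_; _≢_)

-- Strict linear preference orders on a subset, given as duplicate-free
-- lists (most preferred first).

Prefers : {A : Set} → List A → A → A → Set
Prefers xs a b =
  Σ (Fin (length xs)) λ i → Σ (Fin (length xs)) λ j →
    (Data.Fin.toℕ i < Data.Fin.toℕ j) × (lookup xs i ≡ a) × (lookup xs j ≡ b)

record Instance (m n : ℕ) : Set where
  field
    prefS    : Fin m → List (Fin n)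
    prefR    : Fin n → List (Fin m)
    uniqueS  : ∀ s → Unique (prefS s)
    uniqueR  : ∀ r → Unique (prefR r)

module _ {m n : ℕ} (I : Instance m n) where
  open Instance I

  record Matching : Set where
    field
      partner : Fin m → Maybe (Fin n)
      inj     : ∀ {s s' r} → partner s ≡ just r → partner s' ≡ just r → s ≡ s'

  MutuallyAcceptable : Fin m → Fin n → Set
  MutuallyAcceptable s r = (r ∈ prefS s) × (s ∈ prefR r)

  Blocking : Matching → Fin m → Fin n → Set
  Blocking μ s r =
    MutuallyAcceptable s r × (partner s ≢ just r)
    × ((partner s ≡ nothing) ⊎ (∃ λ r' → (partner s ≡ just r') × Prefers (prefS s) r r'))
    × ((∀ s' → partner s' ≢ just r) ⊎ (∃ λ s' → (partner s' ≡ just r) × Prefers (prefR r) s s'))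
    where open Matching μ

  Stable : Matching → Set
  Stable μ =
    (∀ s r → partner s ≡ just r → MutuallyAcceptable s r)
    × (∀ s r → ¬ Blocking μ s r)
    where open Matching μ

  StablyMatchable : Fin m → Fin n → Set
  StablyMatchable s r = Σ Matching λ μ → Stable μ × (Matching.partner μ s ≡ just r)

  Vertex : Set
  Vertex = Fin m ⊎ Fin n

  GSMPEdge : Vertex → Vertex → Set
  GSMPEdge (inj₁ s) (inj₂ r) = StablyMatchable s r
  GSMPEdge (inj₂ r) (inj₁ s) = StablyMatchable s r
  GSMPEdge (inj₁ _) (inj₁ _) = ⊥
  GSMPEdge (inj₂ _) (inj₂ _) = ⊥

module _ {V : Set} (E : V → V → Set) where

  data Connected (P : V → Set) : V → V → Set where
    here : ∀ {u} → P u → Connected P u u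
    step : ∀ {u x w} → P u → E u x → Connected P x w → Connected P u w

  AtLeastComponents : (P : V → Set) → ℕ → Set
  AtLeastComponents P c =
    Σ (Fin c → V) λ f → (∀ i → P (f i)) × (∀ i j → i ≢ j → ¬ Connected P (f i) (f j))

  Articulation : V → Set
  Articulation v =
    ∃ λ c → AtLeastComponents (λ u → u ≢ v) c × ¬ AtLeastComponents (λ _ → ⊤) c

-- If v were an articulation vertex, some walk between two vertices other than v
-- could not be rerouted around v; so it suffices that any two neighbours of v
-- are joined by a walk avoiding v.  Two neighbours of v are its partners in
-- stable matchings A and B.  If a student x prefers its A-partner, then that
-- residency's B-partner exists and is preferred by it to x (else x and it block
-- B), and that student in turn prefers its A-partner (else it blocks A).
-- Iterating traces a cycle alternating between A- and B-edges, which closes up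
-- by finiteness and injectivity; walking around it from one neighbour of v
-- reaches the other without passing through v.
module Submission where

open import Defs
open import Data.Nat using (ℕ; zero; suc; _+_)
open import Data.Nat.Properties using (<-cmp; n<1+n; +-suc; m≤n⇒∃[o]m+o≡n)
open import Data.Fin using (Fin; toℕ; _≟_)
open import Data.Fin.Properties using (toℕ-injective; any?; pigeonhole)
open import Data.Maybe using (Maybe; just; nothing)
import Data.Maybe.Properties as Maybe
open import Data.Sum using (_⊎_; inj₁; inj₂)
import Data.Sum.Properties as Sum
open import Data.List using (List; lookup)
open import Data.List.Membership.Propositional using (_∈_)
open import Data.List.Relation.Unary.Any using (index)
open import Data.List.Relation.Unary.Any.Properties using (lookup-index)
open import Data.Product using (Σ; ∃; _×_; _,_; proj₁; proj₂)
open import Data.Unit using (⊤; tt)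
open import Data.Empty using (⊥-elim)
open import Function using (_∘_)
open import Relation.Nullary using (¬_; yes; no)
open import Relation.Binary using (DecidableEquality; tri<; tri≈; tri>)
open import Relation.Binary.PropositionalEquality

prefers-total : {A : Set} (xs : List A) {a b : A} →
                a ∈ xs → b ∈ xs → a ≢ b → Prefers xs a b ⊎ Prefers xs b a
prefers-total xs a∈xs b∈xs a≢b with <-cmp (toℕ (index a∈xs)) (toℕ (index b∈xs))
... | tri< i<j _ _ = inj₁ (index a∈xs , index b∈xs , i<j , sym (lookup-index a∈xs) , sym (lookup-index b∈xs))
... | tri≈ _ i≡j _ = ⊥-elim (a≢b (begin
        _                           ≡⟨ lookup-index a∈xs ⟩
        lookup xs (index a∈xs)      ≡⟨ cong (lookup xs) (toℕ-injective i≡j) ⟩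
        lookup xs (index b∈xs)      ≡⟨ lookup-index b∈xs ⟨
        _                           ∎))
  where open ≡-Reasoning
... | tri> _ _ j<i = inj₂ (index b∈xs , index a∈xs , j<i , sym (lookup-index b∈xs) , sym (lookup-index a∈xs))

module _ {V : Set} {E : V → V → Set} {P : V → Set} where

  Connected-start : ∀ {u w} → Connected E P u w → P u
  Connected-start (here pu)     = pu
  Connected-start (step pu _ _) = pu

  Connected-end : ∀ {u w} → Connected E P u w → P w
  Connected-end (here pw)       = pw
  Connected-end (step _ _ rest) = Connected-end rest

  Connected-trans : ∀ {u x w} → Connected E P u x → Connected E P x w → Connected E P u w
  Connected-trans (here _)        q = q
  Connected-trans (step pu e rest) q = step pu e (Connected-trans rest q)

  Connected-sym : (∀ {a b} → E a b → E b a) → ∀ {u w} → Connected E P u w → Connected E P w u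
  Connected-sym E-sym (here pu)        = here pu
  Connected-sym E-sym (step pu e rest) =
    Connected-trans (Connected-sym E-sym rest) (step (Connected-start rest) (E-sym e) (here pu))

module _ {V : Set} (E : V → V → Set) (_≟V_ : DecidableEquality V) {v : V}
         (neighbours-connected : ∀ {u w} → E u v → E v w → Connected E (_≢ v) u w) where

  bypass : ∀ {u w} → Connected E (λ _ → ⊤) u w → u ≢ v → w ≢ v → Connected E (_≢ v) u w
  bypass (here _) u≢v _ = here u≢v
  bypass (step {x = x} _ e rest) u≢v w≢v with x ≟V v
  ... | no x≢v = step u≢v e (bypass rest x≢v w≢v)
  bypass (step _ e (here _))              _ w≢v | yes refl = ⊥-elim (w≢v refl)
  bypass (step _ e (step _ e′ rest)) _ w≢v      | yes refl =
    -- the vertex after v is not v, being the end of a walk that avoids v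
    Connected-trans around (bypass rest (Connected-end around) w≢v)
    where around = neighbours-connected e e′

no-articulation : {V : Set} (E : V → V → Set) {v : V} →
                  (∀ {u w} → Connected E (λ _ → ⊤) u w → u ≢ v → w ≢ v → Connected E (_≢ v) u w) →
                  ¬ Articulation E v
no-articulation E reroute (c , (f , f≢v , separated) , ¬components) =
  ¬components (f , (λ _ → tt) , λ i j i≢j path → separated i j i≢j (reroute path (f≢v i) (f≢v j)))

module _ {m n : ℕ} (I : Instance m n) where
  open Instance I

  G : Vertex I → Vertex I → Set
  G = GSMPEdge I

  G-sym : ∀ {a b} → G a b → G b a
  G-sym {inj₁ _} {inj₂ _} e = e
  G-sym {inj₂ _} {inj₁ _} e = e

  StableMatching : Set
  StableMatching = Σ (Matching I) (Stable I)

  module _ (A : StableMatching) where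
    partner : Fin m → Maybe (Fin n)
    partner = Matching.partner (proj₁ A)

    partner-injective : ∀ {s s′ r} → partner s ≡ just r → partner s′ ≡ just r → s ≡ s′
    partner-injective = Matching.inj (proj₁ A)

    acceptable : ∀ {s r} → partner s ≡ just r → MutuallyAcceptable I s r
    acceptable = proj₁ (proj₂ A) _ _

    unblocked : ∀ s r → ¬ Blocking I (proj₁ A) s r
    unblocked = proj₂ (proj₂ A)

    edge : ∀ {s r} → partner s ≡ just r → StablyMatchable I s r
    edge p = proj₁ A , proj₂ A , p

  partner-functional : ∀ (A : StableMatching) {s r r′} →
                       partner A s ≡ just r → partner A s ≡ just r′ → r ≡ r′
  partner-functional A p p′ = Maybe.just-injective (trans (sym p) p′)

  record Favours (A B : StableMatching) (x : Fin m) : Set where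
    field
      fst snd     : Fin n
      matched-fst : partner A x ≡ just fst
      matched-snd : partner B x ≡ just snd
      fst≢snd     : fst ≢ snd
      prefers     : Prefers (prefS x) fst snd
  open Favours

  rival-blocks : ∀ (A B : StableMatching) {y x a} → partner B y ≡ just a → partner A x ≡ just a →
                 y ≢ x → Prefers (prefR a) y x →
                 ((partner A y ≡ nothing) ⊎ ∃ λ r → partner A y ≡ just r × Prefers (prefS y) a r) →
                 Blocking I (proj₁ A) y a
  rival-blocks A B {y} {x} By≡a Ax≡a y≢x a-prefers-y y-free-or-prefers-a =
    acceptable B By≡a , (λ Ay≡a → y≢x (partner-injective A Ay≡a Ax≡a)) ,
    y-free-or-prefers-a , inj₂ (x , Ax≡a , a-prefers-y)

  favours-of-rival : ∀ (A B : StableMatching) {y x a} → partner B y ≡ just a → partner A x ≡ just a →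
                     y ≢ x → Prefers (prefR a) y x → Favours A B y
  favours-of-rival A B {y} {x} {a} By≡a Ax≡a y≢x a-prefers-y with partner A y in Ay≡r
  ... | nothing = ⊥-elim (unblocked A y a (rival-blocks A B By≡a Ax≡a y≢x a-prefers-y (inj₁ Ay≡r)))
  ... | just r with r ≟ a
  ...   | yes refl = ⊥-elim (y≢x (partner-injective A Ay≡r Ax≡a))
  ...   | no r≢a with prefers-total (prefS y) (proj₁ (acceptable A Ay≡r)) (proj₁ (acceptable B By≡a)) r≢a
  ...     | inj₁ y-prefers-r = record
            { fst = r ; snd = a ; matched-fst = Ay≡r ; matched-snd = By≡a
            ; fst≢snd = r≢a ; prefers = y-prefers-r }
  ...     | inj₂ y-prefers-a =
    ⊥-elim (unblocked A y a (rival-blocks A B By≡a Ax≡a y≢x a-prefers-y (inj₂ (r , Ay≡r , y-prefers-a))))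

  favoured-blocks : ∀ (A B : StableMatching) {x} (g : Favours A B x) →
                    ((∀ y → partner B y ≢ just (fst g)) ⊎
                     ∃ λ y → partner B y ≡ just (fst g) × Prefers (prefR (fst g)) x y) →
                    Blocking I (proj₁ B) x (fst g)
  favoured-blocks A B g fst-free-or-prefers-x =
    acceptable A (matched-fst g) , (λ Bx≡a → fst≢snd g (partner-functional B Bx≡a (matched-snd g))) ,
    inj₂ (snd g , matched-snd g , prefers g) , fst-free-or-prefers-x

  next : ∀ (A B : StableMatching) {x} (g : Favours A B x) →
         Σ (Fin m) λ y → partner B y ≡ just (fst g) × Favours A B y
  next A B {x} g with any? (λ y → Maybe.≡-dec _≟_ (partner B y) (just (fst g)))
  ... | no fst-free = ⊥-elim (unblocked B x (fst g) (favoured-blocks A B g (inj₁ λ y By≡a → fst-free (y , By≡a))))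
  ... | yes (y , By≡a) with y ≟ x
  ...   | yes refl = ⊥-elim (fst≢snd g (partner-functional B By≡a (matched-snd g)))
  ...   | no y≢x with prefers-total (prefR (fst g)) (proj₂ (acceptable B By≡a)) (proj₂ (acceptable A (matched-fst g))) y≢x
  ...     | inj₁ prefers-y = y , By≡a , favours-of-rival A B By≡a (matched-fst g) y≢x prefers-y
  ...     | inj₂ prefers-x = ⊥-elim (unblocked B x (fst g) (favoured-blocks A B g (inj₂ (y , By≡a , prefers-x))))

  module AlternatingCycle (A B : StableMatching) {x₀ : Fin m} (g₀ : Favours A B x₀) where
    orbit : ℕ → Σ (Fin m) (Favours A B)
    orbit zero    = x₀ , g₀
    orbit (suc k) = proj₁ successor , proj₂ (proj₂ successor)
      where successor = next A B (proj₂ (orbit k))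

    x : ℕ → Fin m
    x k = proj₁ (orbit k)

    a : ℕ → Fin n
    a k = fst (proj₂ (orbit k))

    b₀ : Fin n
    b₀ = snd g₀

    A-edge : ∀ k → partner A (x k) ≡ just (a k)
    A-edge k = matched-fst (proj₂ (orbit k))

    B-edge : ∀ k → partner B (x (suc k)) ≡ just (a k)
    B-edge k = proj₁ (proj₂ (next A B (proj₂ (orbit k))))

    x-suc-injective : ∀ {i j} → x (suc i) ≡ x (suc j) → x i ≡ x j
    x-suc-injective {i} {j} eq =
      partner-injective A (A-edge i) (subst (λ r → partner A (x j) ≡ just r) (sym aᵢ≡aⱼ) (A-edge j))
      where aᵢ≡aⱼ = partner-functional B (B-edge i) (subst (λ y → partner B y ≡ just (a j)) (sym eq) (B-edge j))

    x-shift : ∀ i k → x i ≡ x (i + k) → x 0 ≡ x k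
    x-shift zero    k eq = eq
    x-shift (suc i) k eq = x-shift i k (x-suc-injective {i} {i + k} eq)

    returns : ∃ λ d → x (suc d) ≡ x₀
    returns with i , j , i<j , xᵢ≡xⱼ ← pigeonhole (n<1+n m) (λ i → x (toℕ i))
            with d , i+1+d≡j ← m≤n⇒∃[o]m+o≡n i<j
      = d , sym (x-shift (toℕ i) (suc d) (trans xᵢ≡xⱼ (cong x (trans (sym i+1+d≡j) (sym (+-suc (toℕ i) d))))))

    -- The cycle x₀ –A– a₀ –B– x₁ –A– a₁ –B– … closes when some xₖ₊₁ = x₀, and then aₖ = b₀.
    Trail : ℕ → Set
    Trail k = Connected G (_≢ inj₁ x₀) (inj₂ (a k)) (inj₂ (a 0))
            × Connected G (_≢ inj₂ b₀) (inj₁ (x k)) (inj₁ x₀)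

    Closed : Set
    Closed = Connected G (_≢ inj₁ x₀) (inj₂ b₀) (inj₂ (a 0))
           × ∃ λ y → partner A y ≡ just b₀ × Connected G (_≢ inj₂ b₀) (inj₁ y) (inj₁ x₀)

    close : ∀ k → x (suc k) ≡ x₀ → Trail k → Closed
    close k returned (to-a₀ , to-x₀) =
      subst (λ r → Connected G _ (inj₂ r) _) aₖ≡b₀ to-a₀ ,
      x k , subst (λ r → partner A (x k) ≡ just r) aₖ≡b₀ (A-edge k) , to-x₀
      where
      aₖ≡b₀ : a k ≡ b₀
      aₖ≡b₀ = partner-functional B (subst (λ y → partner B y ≡ just (a k)) returned (B-edge k)) (matched-snd g₀)

    extend : ∀ k → x (suc k) ≢ x₀ → Trail k → Trail (suc k)
    extend k not-returned (to-a₀ , to-x₀) =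
      step (λ ()) (edge A (A-edge (suc k))) (step (not-returned ∘ Sum.inj₁-injective) (edge B (B-edge k)) to-a₀) ,
      step (λ ()) (edge B (B-edge k)) (step aₖ≢b₀ (edge A (A-edge k)) to-x₀)
      where
      aₖ≢b₀ : inj₂ (a k) ≢ inj₂ b₀
      aₖ≢b₀ eq = not-returned (partner-injective B (B-edge k)
        (subst (λ r → partner B x₀ ≡ just r) (sym (Sum.inj₂-injective eq)) (matched-snd g₀)))

    trail : ∀ k → Closed ⊎ Trail k
    trail zero = inj₂ (here (λ ()) , here (λ ()))
    trail (suc k) with trail k
    ... | inj₁ c = inj₁ c
    ... | inj₂ t with x (suc k) ≟ x₀
    ...   | yes returned    = inj₁ (close k returned t)
    ...   | no not-returned = inj₂ (extend k not-returned t)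

    closed : Closed
    closed with d , returned ← returns with trail d
    ... | inj₁ c = c
    ... | inj₂ t = close d returned t

  favoured-partners-connected : ∀ (A B : StableMatching) {x} (g : Favours A B x) →
                                Connected G (_≢ inj₁ x) (inj₂ (snd g)) (inj₂ (fst g))
  favoured-partners-connected A B g = proj₁ (AlternatingCycle.closed A B g)

  rivals-connected : ∀ (A B : StableMatching) {x y t} →
                     Favours A B x → partner B x ≡ just t → partner A y ≡ just t →
                     Connected G (_≢ inj₂ t) (inj₁ y) (inj₁ x)
  rivals-connected A B g Bx≡t Ay≡t with AlternatingCycle.closed A B g
  ... | _ , y′ , Ay′≡b₀ , path rewrite partner-functional B (matched-snd g) Bx≡t
        | partner-injective A Ay′≡b₀ Ay≡t = path

  student-partners-connected : ∀ (A A′ : StableMatching) {s r r′} →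
                               partner A s ≡ just r → partner A′ s ≡ just r′ →
                               Connected G (_≢ inj₁ s) (inj₂ r) (inj₂ r′)
  student-partners-connected A A′ {s} {r} {r′} As≡r A′s≡r′ with r ≟ r′
  ... | yes refl = here (λ ())
  ... | no r≢r′ with prefers-total (prefS s) (proj₁ (acceptable A As≡r)) (proj₁ (acceptable A′ A′s≡r′)) r≢r′
  ...   | inj₁ prefers-r  = Connected-sym G-sym (favoured-partners-connected A A′
            record { fst = r ; snd = r′ ; matched-fst = As≡r ; matched-snd = A′s≡r′
                   ; fst≢snd = r≢r′ ; prefers = prefers-r })
  ...   | inj₂ prefers-r′ = favoured-partners-connected A′ A
            record { fst = r′ ; snd = r ; matched-fst = A′s≡r′ ; matched-snd = As≡r
                   ; fst≢snd = r≢r′ ∘ sym ; prefers = prefers-r′ }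

  residency-partners-connected : ∀ (A A′ : StableMatching) {s₁ s₂ t} →
                                 partner A s₁ ≡ just t → partner A′ s₂ ≡ just t →
                                 Connected G (_≢ inj₂ t) (inj₁ s₁) (inj₁ s₂)
  residency-partners-connected A A′ {s₁} {s₂} {t} As₁≡t A′s₂≡t with s₁ ≟ s₂
  ... | yes refl = here (λ ())
  ... | no s₁≢s₂ with prefers-total (prefR t) (proj₂ (acceptable A As₁≡t)) (proj₂ (acceptable A′ A′s₂≡t)) s₁≢s₂
  ...   | inj₁ prefers-s₁ = Connected-sym G-sym (rivals-connected A′ A
            (favours-of-rival A′ A As₁≡t A′s₂≡t s₁≢s₂ prefers-s₁) As₁≡t A′s₂≡t)
  ...   | inj₂ prefers-s₂ = rivals-connected A A′
            (favours-of-rival A A′ A′s₂≡t As₁≡t (s₁≢s₂ ∘ sym) prefers-s₂) A′s₂≡t As₁≡t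

  neighbours-connected : ∀ {u v w} → G u v → G v w → Connected G (_≢ v) u w
  neighbours-connected {inj₂ _} {inj₁ _} {inj₂ _} (μ , μ-stable , p) (μ′ , μ′-stable , p′) =
    student-partners-connected (μ , μ-stable) (μ′ , μ′-stable) p p′
  neighbours-connected {inj₁ _} {inj₂ _} {inj₁ _} (μ , μ-stable , p) (μ′ , μ′-stable , p′) =
    residency-partners-connected (μ , μ-stable) (μ′ , μ′-stable) p p′
  neighbours-connected {inj₁ _} {inj₁ _} ()
  neighbours-connected {inj₂ _} {inj₂ _} ()
  neighbours-connected {_} {inj₁ _} {inj₁ _} _ ()
  neighbours-connected {_} {inj₂ _} {inj₂ _} _ ()

lemma8 : ∀ {m n : ℕ} (I : Instance m n) (v : Vertex I) → ¬ Articulation (GSMPEdge I) v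
lemma8 I v = no-articulation (GSMPEdge I) (bypass (GSMPEdge I) (Sum.≡-dec _≟_ _≟_) (neighbours-connected I))
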